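{- Let $G$ be an antisymmetric digraph that is homomorphically full (as an antisymmetric digraph). Then its underlying graph $U(G)$ is a homomorphically full graph.
   Context: All graphs and digraphs are finite, loopless, and without multiple edges/arcs. A homomorphism $\phi$ of a graph (resp. digraph) $\Gamma$ to $\Lambda$ is a map $V(\Gamma)\to V(\Lambda)$ sending edges (resp. arcs) to edges (resp. arcs); it is complete if it is surjective on vertices and the induced map on edges (resp. arcs) is surjective. An antisymmetric digraph is a digraph with no directed $2$-cycle. For an antisymmetric digraph $G$, a homomorphic image of $G$ is a loopless digraph $H$ (which may contain directed $2$-cycles) admitting a complete homomorphism $G\to H$; $G$ is homomorphically full if every homomorphic image of $G$ is isomorphic to a subgraph of $G$. For a simple graph $\Gamma$, a homomorphic image is a simple loopless graph $\Lambda$ with a complete homomorphism $\Gamma\to\Lambda$, and $\Gamma$ is homomorphically full if every homomorphic image of $\Gamma$ is isomorphic to a subgraph of $\Gamma$. The underlying graph $U(G)$ is the simple graph obtained by forgetting arc directions. -}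

module Defs where

open import Data.Nat using (ℕ)
open import Data.Fin using (Fin)
open import Data.Bool using (Bool; true; false; _∨_)
open import Data.Bool.Properties using (∨-comm)
open import Data.Product using (Σ; ∃; _×_; _,_)
open import Relation.Binary.PropositionalEquality using (_≡_; refl; cong₂)
open import Function.Definitions using (Injective)

-- A finite loopless digraph on vertex set Fin n, arcs given by a Boolean
-- adjacency relation (so there are no multiple arcs). Directed 2-cycles allowed.
record Digraph : Set where
  field
    n        : ℕ
    arc      : Fin n → Fin n → Bool
    loopless : ∀ x → arc x x ≡ false
open Digraph public

Antisymmetric : Digraph → Set
Antisymmetric G = ∀ x y → arc G x y ≡ true → arc G y x ≡ false

-- A finite simple loopless graph: a digraph with symmetric adjacency
-- (each edge {x,y} is recorded as both ordered pairs).
record Graph : Set where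
  field
    dg  : Digraph
    sym : ∀ x y → arc dg x y ≡ arc dg y x
open Graph public

-- Homomorphisms (of digraphs; for graphs, applied to the symmetric adjacency).
IsHom : (G H : Digraph) → (Fin (n G) → Fin (n H)) → Set
IsHom G H φ = ∀ x y → arc G x y ≡ true → arc H (φ x) (φ y) ≡ true

IsComplete : (G H : Digraph) → (Fin (n G) → Fin (n H)) → Set
IsComplete G H φ =
  IsHom G H φ
  × (∀ u → ∃ λ x → φ x ≡ u)
  × (∀ u v → arc H u v ≡ true →
       ∃ λ x → ∃ λ y → φ x ≡ u × φ y ≡ v × arc G x y ≡ true)

-- H is isomorphic to a subgraph (not necessarily induced) of G:
-- there is an injective homomorphism H → G.
IsoToSubgraph : (H G : Digraph) → Set
IsoToSubgraph H G = Σ (Fin (n H) → Fin (n G)) λ ψ → Injective _≡_ _≡_ ψ × IsHom H G ψ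

-- Homomorphically full antisymmetric digraph: every homomorphic image
-- (any loopless digraph, possibly with 2-cycles) is isomorphic to a subgraph.
DigraphHomFull : Digraph → Set
DigraphHomFull G =
  ∀ (H : Digraph) (φ : Fin (n G) → Fin (n H)) → IsComplete G H φ → IsoToSubgraph H G

GraphHomFull : Graph → Set
GraphHomFull Γ =
  ∀ (Λ : Graph) (φ : Fin (n (dg Γ)) → Fin (n (dg Λ))) →
    IsComplete (dg Γ) (dg Λ) φ → IsoToSubgraph (dg Λ) (dg Γ)

private
  ulaw : (G : Digraph) → ∀ x → (arc G x x ∨ arc G x x) ≡ false
  ulaw G x with arc G x x | loopless G x
  ... | false | refl = refl

U : Digraph → Graph
U G = record
  { dg  = record { n = n G ; arc = λ x y → arc G x y ∨ arc G y x ; loopless = ulaw G }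
  ; sym = λ x y → ∨-comm (arc G x y) (arc G y x)
  }

-- Given a complete homomorphism φ : U(G) → Λ, push the arcs of G forward
-- along φ: this gives a loopless digraph H on the vertices of Λ and a complete
-- homomorphism G → H, so fullness of G yields an injective homomorphism
-- ψ : H → G.  Every edge of Λ is the image of an arc of G in one of its two
-- directions, hence an arc of H in that direction, so ψ maps it to an edge of
-- U(G).
module Submission where

open import Defs hiding (sym)
open import Data.Bool using (true; false)
open import Data.Bool.Properties using (∨-zeroʳ) renaming (_≟_ to _≟ᵇ_)
open import Data.Empty using (⊥-elim)
open import Data.Fin using (Fin; _≟_)
open import Data.Fin.Properties using (any?)
open import Data.Product using (∃; _×_; _,_)
open import Data.Sum using (_⊎_; inj₁; inj₂)
open import Relation.Nullary using (Dec; yes; no)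
open import Relation.Nullary.Decidable using (isYes; _×-dec_)
open import Relation.Binary.PropositionalEquality using (_≡_; refl; sym; trans; subst)

module _ (G : Digraph) {x y : Fin (n G)} where

  U-arcˡ : arc G x y ≡ true → arc (dg (U G)) x y ≡ true
  U-arcˡ a rewrite a = refl

  U-arcʳ : arc G y x ≡ true → arc (dg (U G)) x y ≡ true
  U-arcʳ a rewrite a = ∨-zeroʳ (arc G x y)

  U-arc-elim : arc (dg (U G)) x y ≡ true → arc G x y ≡ true ⊎ arc G y x ≡ true
  U-arc-elim e with arc G x y
  ... | true  = inj₁ refl
  ... | false = inj₂ e

hom-from-U : (G K : Digraph) (φ : Fin (n G) → Fin (n K)) →
             IsHom (dg (U G)) K φ → IsHom G K φ
hom-from-U G K φ hom x y a = hom x y (U-arcˡ G a)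

module Image (G K : Digraph) (φ : Fin (n G) → Fin (n K)) where

  ArcImage : Fin (n K) → Fin (n K) → Set
  ArcImage u v = ∃ λ x → ∃ λ y → φ x ≡ u × φ y ≡ v × arc G x y ≡ true

  arcImage? : ∀ u v → Dec (ArcImage u v)
  arcImage? u v =
    any? λ x → any? λ y → (φ x ≟ u) ×-dec ((φ y ≟ v) ×-dec (arc G x y ≟ᵇ true))

  arcImage-irreflexive : IsHom G K φ → ∀ u → isYes (arcImage? u u) ≡ false
  arcImage-irreflexive hom u with arcImage? u u
  ... | no _ = refl
  ... | yes (x , y , refl , φy≡φx , a)
    with trans (sym (subst (λ w → arc K (φ x) w ≡ true) φy≡φx (hom x y a))) (loopless K (φ x))
  ... | ()

  image : IsHom G K φ → Digraph
  image hom = record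
    { n        = n K
    ; arc      = λ u v → isYes (arcImage? u v)
    ; loopless = arcImage-irreflexive hom
    }

  module _ (hom : IsHom G K φ) where

    image-arc⁺ : ∀ {u v} → ArcImage u v → arc (image hom) u v ≡ true
    image-arc⁺ {u} {v} p with arcImage? u v
    ... | yes _ = refl
    ... | no ¬p = ⊥-elim (¬p p)

    image-arc⁻ : ∀ {u v} → arc (image hom) u v ≡ true → ArcImage u v
    image-arc⁻ {u} {v} e with arcImage? u v
    ... | yes p = p
    image-arc⁻ () | no _

    image-complete : (∀ u → ∃ λ x → φ x ≡ u) → IsComplete G (image hom) φ
    image-complete surj =
      (λ x y a → image-arc⁺ (x , y , refl , refl , a)) , surj , λ u v → image-arc⁻

    image-hom⇒U-hom :
      (∀ u v → arc K u v ≡ true →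
         ∃ λ x → ∃ λ y → φ x ≡ u × φ y ≡ v × arc (dg (U G)) x y ≡ true) →
      (ψ : Fin (n K) → Fin (n G)) → IsHom (image hom) G ψ → IsHom K (dg (U G)) ψ
    image-hom⇒U-hom lift ψ hψ u v a with lift u v a
    ... | x , y , φx≡u , φy≡v , e with U-arc-elim G e
    ...   | inj₁ xy = U-arcˡ G (hψ u v (image-arc⁺ (x , y , φx≡u , φy≡v , xy)))
    ...   | inj₂ yx = U-arcʳ G (hψ v u (image-arc⁺ (y , x , φy≡v , φx≡u , yx)))

open Image

lemma2 : (G : Digraph) → Antisymmetric G → DigraphHomFull G → GraphHomFull (U G)
lemma2 G _ full Λ φ (hom , surj , lift) =
  let ψ , ψ-injective , ψ-hom = full (image G K φ homG) φ (image-complete G K φ homG surj)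
  in  ψ , ψ-injective , image-hom⇒U-hom G K φ homG lift ψ ψ-hom
  where
  K : Digraph
  K = dg Λ

  homG : IsHom G K φ
  homG = hom-from-U G K φ hom
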